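{- Let $k\ge2$ and $m>n\ge2$ be integers. The following are equivalent: (1) there exist functions $g,f_0,\dots,f_{k-1}:m\to n$ with no $\mathsf{PHP}^m_n$-solution in common (i.e., there is no pair $\{i,j\}$, $i\ne j$, that is a solution to all of $g,f_0,\dots,f_{k-1}$); (2) $\mathsf{ACC}_k\le_{\mathrm W}(\mathsf{PHP}^m_n)'$; (3) $\mathsf{ACC}_k\le^*_{\mathrm W}(\mathsf{PHP}^m_n)'$.
   Context: A number $N\ge1$ is identified with $\{0,\dots,N-1\}$. A problem $\mathsf{P}$ consists of a nonempty set of instances and, for each instance, a nonempty set of solutions; instances and solutions are coded as elements of Baire space $\mathbb N^{\mathbb N}$ in a standard way. $\mathsf{P}\le_{\mathrm W}\mathsf{Q}$ (Weihrauch reducibility) if there are Turing functionals (effectively continuous partial maps on $\mathbb N^{\mathbb N}$) $\Phi,\Psi$ such that for every $\mathsf{P}$-instance $p$, $\Phi(p)$ is a $\mathsf{Q}$-instance and for every $\mathsf{Q}$-solution $q$ of $\Phi(p)$, $\Psi(p,q)$ is a $\mathsf{P}$-solution of $p$; $\le^*_{\mathrm W}$ is the same with $\Phi,\Psi$ merely continuous. For $m>n\ge2$, $\mathsf{PHP}^m_n$ has as instances all functions $f:m\to n$, with solutions all unordered pairs $\{i,j\}$, $i\ne j$, $f(i)=f(j)$; its jump $(\mathsf{PHP}^m_n)'$ has as instances all pointwise convergent sequences $(f_s:m\to n)_{s\in\mathbb N}$, with solutions all $\{i,j\}$, $i\ne j$, $\lim_s f_s(i)=\lim_s f_s(j)$.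 For $k\ge2$, $\mathsf{ACC}_k$ has as instances those $p\in\mathbb N^{\mathbb N}$ such that either there is a unique $\ell<k$ that appears in $p$ (then every $j<k$ with $j\ne\ell$ is a solution), or $p$ is the constant sequence with value $k$ (then every $j<k$ is a solution). -}

module Defs where

open import Data.Nat using (ℕ; zero; suc; _+_; _*_; _≤_; _<_)
open import Data.Fin using (Fin; toℕ)
open import Data.Vec using (Vec; []; _∷_; lookup)
open import Data.List using (List; []; _∷_; map; upTo)
open import Data.Product using (Σ; _×_; _,_; ∃; ∃-syntax)
open import Data.Sum using (_⊎_)
open import Relation.Binary.PropositionalEquality using (_≡_; _≢_)
open import Relation.Nullary using (¬_)
open import Data.Unit using (⊤)

Baire : Set
Baire = ℕ → ℕ

prefix : Baire → ℕ → List ℕ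
prefix p t = map p (upTo t)

-- pairing ⟨p,q⟩ of two Baire elements by interleaving:
-- ⟨p,q⟩(2x) = p x, ⟨p,q⟩(2x+1) = q x
interleave : Baire → Baire → Baire
interleave p q zero          = p 0
interleave p q (suc zero)    = q 0
interleave p q (suc (suc x)) = interleave (λ y → p (suc y)) (λ y → q (suc y)) x

tri : ℕ → ℕ
tri zero    = 0
tri (suc n) = suc n + tri n

cantor : ℕ → ℕ → ℕ
cantor a b = tri (a + b) + b

codeList : List ℕ → ℕ
codeList []       = 0
codeList (x ∷ xs) = suc (cantor x (codeList xs))

data PR : ℕ → Set where
  zer  : PR 0
  succ : PR 1
  proj : ∀ {n} → Fin n → PR n
  comp : ∀ {n k} → PR k → Vec (PR n) k → PR n
  prec : ∀ {n} → PR n → PR (suc (suc n)) → PR (suc n)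
  mu   : ∀ {n} → PR (suc n) → PR n

data _[_]⇓_ : ∀ {n} → PR n → Vec ℕ n → ℕ → Set
data _[_]⇓*_ : ∀ {n k} → Vec (PR n) k → Vec ℕ n → Vec ℕ k → Set

data _[_]⇓_ where
  ev-zer  : zer [ [] ]⇓ 0
  ev-succ : ∀ {x} → succ [ x ∷ [] ]⇓ suc x
  ev-proj : ∀ {n} {i : Fin n} {xs} → proj i [ xs ]⇓ lookup xs i
  ev-comp : ∀ {n k} {f : PR k} {gs : Vec (PR n) k} {xs ys y} →
            gs [ xs ]⇓* ys → f [ ys ]⇓ y → comp f gs [ xs ]⇓ y
  ev-prec-z : ∀ {n} {f : PR n} {g : PR (suc (suc n))} {xs y} →
              f [ xs ]⇓ y → prec f g [ 0 ∷ xs ]⇓ y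
  ev-prec-s : ∀ {n} {f : PR n} {g : PR (suc (suc n))} {xs x y z} →
              prec f g [ x ∷ xs ]⇓ y → g [ x ∷ y ∷ xs ]⇓ z →
              prec f g [ suc x ∷ xs ]⇓ z
  ev-mu   : ∀ {n} {f : PR (suc n)} {xs y} →
            f [ y ∷ xs ]⇓ 0 →
            (∀ z → z < y → Σ ℕ λ w → f [ z ∷ xs ]⇓ suc w) →
            mu f [ xs ]⇓ y

data _[_]⇓*_ where
  ev-[] : ∀ {n} {xs : Vec ℕ n} → [] [ xs ]⇓* []
  ev-∷  : ∀ {n k} {g : PR n} {gs : Vec (PR n) k} {xs y ys} →
          g [ xs ]⇓ y → gs [ xs ]⇓* ys → (g ∷ gs) [ xs ]⇓* (y ∷ ys)

-- Continuous / computable partial functionals on Baire space,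
-- represented by Kleene associates α : List ℕ → ℕ.

Associate : Set
Associate = List ℕ → ℕ

OutAt : Associate → Baire → ℕ → ℕ → Set
OutAt α p x y =
  Σ ℕ λ t → (α (x ∷ prefix p t) ≡ suc y) ×
            (∀ t′ → t′ < t → α (x ∷ prefix p t′) ≡ 0)

_⊢_↦_ : Associate → Baire → Baire → Set
α ⊢ p ↦ q = ∀ x → OutAt α p x (q x)

Computable : Associate → Set
Computable α = Σ (PR 1) λ e → ∀ l → e [ codeList l ∷ [] ]⇓ α l

AnyAssoc : Associate → Set
AnyAssoc _ = ⊤

record Problem : Set₁ where
  field
    Inst : Baire → Set
    Sol  : Baire → Baire → Set
open Problem

RedWith : (Associate → Set) → Problem → Problem → Set
RedWith Adm P Q =
  Σ Associate λ φ → Σ Associate λ ψ → Adm φ × Adm ψ ×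
    (∀ p → Inst P p →
       Σ Baire λ q → (φ ⊢ p ↦ q) × Inst Q q ×
         (∀ r → Sol Q q r →
            Σ Baire λ s → (ψ ⊢ interleave p r ↦ s) × Sol P p s))

_≤W_ : Problem → Problem → Set
P ≤W Q = RedWith Computable P Q

_≤W*_ : Problem → Problem → Set
P ≤W* Q = RedWith AnyAssoc P Q

natCode : ℕ → Baire
natCode j zero    = j
natCode j (suc _) = 0

pairCode : ℕ → ℕ → Baire
pairCode i j zero          = i
pairCode i j (suc zero)    = j
pairCode i j (suc (suc _)) = 0

Appears : ℕ → Baire → Set
Appears ℓ p = Σ ℕ λ x → p x ≡ ℓ

ACC : ℕ → Problem
ACC k = record
  { Inst = λ p →
      (Σ ℕ λ ℓ → ℓ < k × Appears ℓ p × (∀ ℓ′ → ℓ′ < k → Appears ℓ′ p → ℓ′ ≡ ℓ))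
      ⊎ (∀ x → p x ≡ k)
  ; Sol  = λ p r → Σ ℕ λ j → j < k × (∀ x → r x ≡ natCode j x) ×
      (∀ ℓ → ℓ < k → Appears ℓ p → j ≢ ℓ)
  }

PHPSol : {m n : ℕ} → (Fin m → Fin n) → Fin m → Fin m → Set
PHPSol f i j = i ≢ j × f i ≡ f j

-- a Baire element p codes the sequence (f_s : m → n)_s via f_s(i) = p (s*m + i)
seqAt : (m : ℕ) → Baire → ℕ → ℕ → ℕ
seqAt m p s i = p (s * m + i)

ConvTo : (m : ℕ) → Baire → ℕ → ℕ → Set
ConvTo m p i v = Σ ℕ λ s₀ → ∀ s → s₀ ≤ s → seqAt m p s i ≡ v

PHP′ : (m n : ℕ) → Problem
PHP′ m n = record
  { Inst = λ p → (∀ x → p x < n) × (∀ i → i < m → Σ ℕ λ v → ConvTo m p i v)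
  ; Sol  = λ p r → Σ ℕ λ i → Σ ℕ λ j → i < j × j < m × (∀ x → r x ≡ pairCode i j x) ×
      (Σ ℕ λ v → ConvTo m p i v × ConvTo m p j v)
  }

NoCommonSolution : (m n k : ℕ) → Set
NoCommonSolution m n k =
  Σ (Fin m → Fin n) λ g → Σ (Fin k → Fin m → Fin n) λ f →
    ∀ i j → ¬ (PHPSol g i j × (∀ t → PHPSol (f t) i j))

{-# OPTIONS --safe #-}
module Submission where

-- The instance map turns an ACCₖ-instance p into the sequence that equals g until a
-- value ℓ < k has been read from p, and f ℓ afterwards; its limit is g if p is constantly k and
-- f ℓ if ℓ appears in p. Given a pair {i, j} solving the limit: if g i ≠ g j, some ℓ appears,
-- and we wait for it and answer any value other than ℓ; if {i, j} solves g, we answer a t such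
-- that {i, j} does not solve f t, which exists by (1) and differs from any ℓ that appears.
--
-- Let g be the limit of the image of kᵚ. For each solution {i, j} of g, the solution
-- map answers some ℓ < k after reading a finite prefix of its input; let T bound these moduli,
-- and let f ℓ be the limit of the image of kᵀℓᵚ. If {i, j} solved g and every f ℓ, then on
-- kᵀℓᵚ (for the ℓ answered on kᵚ) the solution map would read the same prefix and answer ℓ
-- again, although ℓ appears in kᵀℓᵚ.

open import Defs
open import Data.Fin as Fin using (Fin; toℕ; #_)
open import Data.Fin.Properties using (toℕ<n; toℕ-fromℕ<; toℕ-injective; ¬∀⟶∃¬)
open import Data.List using ([]; _∷_; drop; length; applyUpTo)
open import Data.List.Properties
  using (length-drop; drop-drop; drop-all; length-applyUpTo; map-upTo; map-cong-local)
open import Data.List.Relation.Unary.All.Properties using (applyUpTo⁺₁)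
open import Data.Nat
  using (ℕ; zero; suc; _+_; _*_; _∸_; _⊔_; _≤_; _<_; z≤n; s≤s; pred; _<?_; _≤?_; _≟_; >-nonZero)
open import Data.Nat.DivMod using (_/_; _%_; m≡m%n+[m/n]*n; m%n<n)
open import Data.Nat.GeneralisedArithmetic using (fold; iterate; iterate-is-fold; +-is-fold)
open import Data.Nat.Properties
open import Data.Product using (Σ; ∃; _×_; _,_; proj₁; proj₂)
open import Data.Sum using (_⊎_; inj₁; inj₂; [_,_]′)
open import Data.Unit using (tt)
open import Data.Vec using (Vec; []; _∷_; lookup)
open import Function using (_∘_; id)
open import Function.Bundles using (_⇔_; mk⇔)
open import Relation.Binary.Definitions using (tri<; tri≈; tri>)
open import Relation.Binary.PropositionalEquality
open import Relation.Nullary using (Dec; yes; no; ¬_; contradiction; ¬?; _×-dec_)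

Recursive : (n : ℕ) → (Vec ℕ n → ℕ) → Set
Recursive n f = Σ (PR n) λ e → ∀ xs → e [ xs ]⇓ f xs

Recursive-≗ : ∀ {n f g} → Recursive n f → f ≗ g → Recursive n g
Recursive-≗ (e , e⇓) f≗g = e , λ xs → subst (e [ xs ]⇓_) (f≗g xs) (e⇓ xs)

unary : (ℕ → ℕ) → Vec ℕ 1 → ℕ
unary f (x ∷ []) = f x

binary : (ℕ → ℕ → ℕ) → Vec ℕ 2 → ℕ
binary f (x ∷ y ∷ []) = f x y

ternary : (ℕ → ℕ → ℕ → ℕ) → Vec ℕ 3 → ℕ
ternary f (x ∷ y ∷ z ∷ []) = f x y z

var : ∀ {n} (i : Fin n) → Recursive n (λ xs → lookup xs i)
var i = proj i , λ _ → ev-proj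

app₁ : ∀ {n f a} → Recursive 1 (unary f) → Recursive n a → Recursive n (λ xs → f (a xs))
app₁ (e , e⇓) (a , a⇓) = comp e (a ∷ []) , λ xs → ev-comp (ev-∷ (a⇓ xs) ev-[]) (e⇓ _)

app₂ : ∀ {n f a b} → Recursive 2 (binary f) → Recursive n a → Recursive n b →
       Recursive n (λ xs → f (a xs) (b xs))
app₂ (e , e⇓) (a , a⇓) (b , b⇓) =
  comp e (a ∷ b ∷ []) , λ xs → ev-comp (ev-∷ (a⇓ xs) (ev-∷ (b⇓ xs) ev-[])) (e⇓ _)

app₃ : ∀ {n f a b c} → Recursive 3 (ternary f) → Recursive n a → Recursive n b → Recursive n c →
       Recursive n (λ xs → f (a xs) (b xs) (c xs))
app₃ (e , e⇓) (a , a⇓) (b , b⇓) (c , c⇓) =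
  comp e (a ∷ b ∷ c ∷ []) , λ xs → ev-comp (ev-∷ (a⇓ xs) (ev-∷ (b⇓ xs) (ev-∷ (c⇓ xs) ev-[]))) (e⇓ _)

sucᴿ : Recursive 1 (unary suc)
sucᴿ = succ , λ { (_ ∷ []) → ev-succ }

const : ∀ {n} (c : ℕ) → Recursive n (λ _ → c)
const zero    = comp zer [] , λ _ → ev-comp ev-[] ev-zer
const (suc c) = app₁ sucᴿ (const c)

primRec : ∀ {n} → (Vec ℕ n → ℕ) → (Vec ℕ (suc (suc n)) → ℕ) → Vec ℕ (suc n) → ℕ
primRec f g (zero  ∷ xs) = f xs
primRec f g (suc x ∷ xs) = g (x ∷ primRec f g (x ∷ xs) ∷ xs)

primRecᴿ : ∀ {n f g} → Recursive n f → Recursive (suc (suc n)) g → Recursive (suc n) (primRec f g)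
primRecᴿ {f = f} {g} (e , e⇓) (d , d⇓) = prec e d , go
  where
  go : ∀ xs → prec e d [ xs ]⇓ primRec f g xs
  go (zero  ∷ xs) = ev-prec-z (e⇓ xs)
  go (suc x ∷ xs) = ev-prec-s (go (x ∷ xs)) (d⇓ _)

foldᴿ : ∀ {s} → Recursive 1 (unary s) → Recursive 2 (binary λ j d → fold d s j)
foldᴿ {s} rs = Recursive-≗ (primRecᴿ (var (# 0)) (app₁ rs (var (# 1))))
  λ { (j ∷ d ∷ []) → primRec-fold j d }
  where
  primRec-fold : ∀ j d → primRec (λ xs → lookup xs (# 0)) (λ xs → s (lookup xs (# 1))) (j ∷ d ∷ [])
                         ≡ fold d s j
  primRec-fold zero    d = refl
  primRec-fold (suc j) d = cong s (primRec-fold j d)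

predᴿ : Recursive 1 (unary pred)
predᴿ = Recursive-≗ (primRecᴿ (const 0) (var (# 0))) λ { (zero ∷ []) → refl ; (suc x ∷ []) → refl }

+ᴿ : Recursive 2 (binary _+_)
+ᴿ = Recursive-≗ (foldᴿ sucᴿ) λ { (x ∷ y ∷ []) → +-is-fold x }

∸ᴿ : Recursive 2 (binary _∸_)
∸ᴿ = Recursive-≗ (app₂ (foldᴿ predᴿ) (var (# 1)) (var (# 0)))
  λ { (x ∷ y ∷ []) → pred-fold y x }
  where
  pred-fold : ∀ y x → fold x pred y ≡ x ∸ y
  pred-fold zero    x = refl
  pred-fold (suc y) x = trans (cong pred (pred-fold y x)) (pred[m∸n]≡m∸[1+n] x y)

ifz : ℕ → ℕ → ℕ → ℕ
ifz zero    a b = a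
ifz (suc _) a b = b

ifzᴿ : Recursive 3 (ternary ifz)
ifzᴿ = Recursive-≗ (primRecᴿ (var (# 0)) (var (# 3)))
  λ { (zero ∷ a ∷ b ∷ []) → refl ; (suc c ∷ a ∷ b ∷ []) → refl }

ifz-≢0 : ∀ {c} a b → c ≢ 0 → ifz c a b ≡ b
ifz-≢0 {zero}  a b c≢0 = contradiction refl c≢0
ifz-≢0 {suc c} a b _   = refl

iterateᴿ : ∀ {f} → Recursive 1 (unary f) → Recursive 2 (binary λ j d → iterate f d j)
iterateᴿ {f} rf = Recursive-≗ (foldᴿ rf) λ { (j ∷ d ∷ []) → iterate-is-fold d f j }

ifLess : ℕ → ℕ → ℕ → ℕ → ℕ
ifLess a b x y = ifz (b ∸ a) y x

ifLess-< : ∀ {a b} x y → a < b → ifLess a b x y ≡ x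
ifLess-< x y a<b = ifz-≢0 y x (m>n⇒m∸n≢0 a<b)

ifLess-≥ : ∀ {a b} x y → b ≤ a → ifLess a b x y ≡ y
ifLess-≥ x y b≤a rewrite m≤n⇒m∸n≡0 b≤a = refl

ifLessᴿ : ∀ {n a b x y} → Recursive n a → Recursive n b → Recursive n x → Recursive n y →
          Recursive n (λ xs → ifLess (a xs) (b xs) (x xs) (y xs))
ifLessᴿ ra rb rx ry = app₃ ifzᴿ (app₂ ∸ᴿ rb ra) ry rx

select : ∀ {N} → (Fin N → ℕ) → ℕ → ℕ
select {zero}  h a = 0
select {suc N} h a = ifz a (h Fin.zero) (select (h ∘ Fin.suc) (pred a))

select-toℕ : ∀ {N} (h : Fin N → ℕ) i → select h (toℕ i) ≡ h i
select-toℕ h Fin.zero    = refl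
select-toℕ h (Fin.suc i) = select-toℕ (h ∘ Fin.suc) i

select-< : ∀ {N b} (h : Fin N → ℕ) → 0 < b → (∀ i → h i < b) → ∀ a → select h a < b
select-< {zero}  h 0<b h<b a       = 0<b
select-< {suc N} h 0<b h<b zero    = h<b Fin.zero
select-< {suc N} h 0<b h<b (suc a) = select-< (h ∘ Fin.suc) 0<b (h<b ∘ Fin.suc) a

selectᴿ : ∀ {N n a} {F : Fin N → Vec ℕ n → ℕ} → (∀ i → Recursive n (F i)) → Recursive n a →
          Recursive n (λ xs → select (λ i → F i xs) (a xs))
selectᴿ {zero}  rF ra = const 0
selectᴿ {suc N} rF ra = app₃ ifzᴿ ra (rF Fin.zero) (selectᴿ (rF ∘ Fin.suc) (app₁ predᴿ ra))

modulo : ℕ → ℕ → ℕ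
modulo m zero    = 0
modulo m (suc x) = ifLess (suc (modulo m x)) m (suc (modulo m x)) 0

modulo-+ : ∀ m′ x {i} → modulo (suc m′) x ≡ 0 → i ≤ m′ → modulo (suc m′) (x + i) ≡ i
modulo-+ m′ x {zero}  mx≡0 _ rewrite +-identityʳ x = mx≡0
modulo-+ m′ x {suc i} mx≡0 si≤m′ rewrite +-suc x i | modulo-+ m′ x mx≡0 (≤-trans (n≤1+n i) si≤m′)
  = ifLess-< (suc i) 0 (s≤s si≤m′)

modulo-* : ∀ m′ s → modulo (suc m′) (s * suc m′) ≡ 0
modulo-* m′ zero = refl
modulo-* m′ (suc s) rewrite +-comm m′ (s * suc m′) | modulo-+ m′ (s * suc m′) (modulo-* m′ s) ≤-refl
  = ifLess-≥ {suc m′} (suc m′) 0 ≤-refl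

modulo-column : ∀ {m} s {i} → i < m → modulo m (s * m + i) ≡ i
modulo-column {suc m′} s (s≤s i≤m′) = modulo-+ m′ (s * suc m′) (modulo-* m′ s) i≤m′

moduloᴿ : ∀ m → Recursive 1 (unary (modulo m))
moduloᴿ m = Recursive-≗ (primRecᴿ (const 0) (ifLessᴿ r+1 (const m) r+1 (const 0)))
  λ { (x ∷ []) → primRec-modulo x }
  where
  r+1 : Recursive 2 (λ xs → suc (lookup xs (# 1)))
  r+1 = app₁ sucᴿ (var (# 1))
  primRec-modulo : ∀ x → primRec (λ _ → 0) (λ xs → ifLess (suc (lookup xs (# 1))) m (suc (lookup xs (# 1))) 0)
                                 (x ∷ [])
                         ≡ modulo m x
  primRec-modulo zero    = refl
  primRec-modulo (suc x) rewrite primRec-modulo x = refl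

triᴿ : Recursive 1 (unary tri)
triᴿ = Recursive-≗ (primRecᴿ (const 0) (app₂ +ᴿ (app₁ sucᴿ (var (# 0))) (var (# 1))))
  λ { (x ∷ []) → primRec-tri x }
  where
  primRec-tri : ∀ x → primRec (λ _ → 0) (λ xs → suc (lookup xs (# 0)) + lookup xs (# 1)) (x ∷ []) ≡ tri x
  primRec-tri zero    = refl
  primRec-tri (suc x) = cong (suc x +_) (primRec-tri x)

tri-mono-≤ : ∀ {a b} → a ≤ b → tri a ≤ tri b
tri-mono-≤ z≤n       = z≤n
tri-mono-≤ (s≤s a≤b) = +-mono-≤ (s≤s a≤b) (tri-mono-≤ a≤b)

triRoot : ℕ → ℕ
triRoot zero    = 0
triRoot (suc z) = ifLess (suc z) (tri (suc (triRoot z))) (triRoot z) (suc (triRoot z))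

triRoot-bounds : ∀ z → tri (triRoot z) ≤ z × z < tri (suc (triRoot z))
triRoot-bounds zero    = z≤n , s≤s z≤n
triRoot-bounds (suc z) with triRoot z | triRoot-bounds z | suc z <? tri (suc (triRoot z))
... | r | lo , hi | yes sz<
  rewrite ifLess-< r (suc r) sz< = m≤n⇒m≤1+n lo , sz<
... | r | lo , hi | no sz≮
  rewrite ifLess-≥ r (suc r) (≮⇒≥ sz≮) = ≮⇒≥ sz≮ , <-≤-trans (s≤s hi) (s≤s (m≤n+m (tri (suc r)) (suc r)))

triRoot-unique : ∀ {z r} → tri r ≤ z → z < tri (suc r) → triRoot z ≡ r
triRoot-unique {z} {r} lo hi with <-cmp (triRoot z) r | triRoot-bounds z
... | tri< triRoot<r _ _ | _ , hi′ = contradiction (≤-trans (tri-mono-≤ triRoot<r) lo) (<⇒≱ hi′)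
... | tri≈ _ triRoot≡r _ | _       = triRoot≡r
... | tri> _ _ r<triRoot | lo′ , _ = contradiction (≤-trans (tri-mono-≤ r<triRoot) lo′) (<⇒≱ hi)

triRootᴿ : Recursive 1 (unary triRoot)
triRootᴿ = Recursive-≗ (primRecᴿ (const 0) step) λ { (z ∷ []) → primRec-triRoot z }
  where
  r = var (# 1)
  step = ifLessᴿ (app₁ sucᴿ (var (# 0))) (app₁ triᴿ (app₁ sucᴿ r)) r (app₁ sucᴿ r)
  primRec-triRoot : ∀ z → primRec (λ _ → 0) (λ xs → ifLess (suc (lookup xs (# 0))) (tri (suc (lookup xs (# 1))))
                                                      (lookup xs (# 1)) (suc (lookup xs (# 1)))) (z ∷ [])
                       ≡ triRoot z
  primRec-triRoot zero    = refl
  primRec-triRoot (suc z) rewrite primRec-triRoot z = refl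

unpair₂ : ℕ → ℕ
unpair₂ z = z ∸ tri (triRoot z)

unpair₁ : ℕ → ℕ
unpair₁ z = triRoot z ∸ unpair₂ z

triRoot-cantor : ∀ a b → triRoot (cantor a b) ≡ a + b
triRoot-cantor a b = triRoot-unique (m≤m+n (tri (a + b)) b) (begin-strict
  tri (a + b) + b           <⟨ +-monoʳ-< (tri (a + b)) (s≤s (m≤n+m b a)) ⟩
  tri (a + b) + suc (a + b) ≡⟨ +-comm (tri (a + b)) (suc (a + b)) ⟩
  tri (suc (a + b))         ∎)
  where open ≤-Reasoning

unpair₂-cantor : ∀ a b → unpair₂ (cantor a b) ≡ b
unpair₂-cantor a b rewrite triRoot-cantor a b = m+n∸m≡n (tri (a + b)) b

unpair₁-cantor : ∀ a b → unpair₁ (cantor a b) ≡ a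
unpair₁-cantor a b rewrite unpair₂-cantor a b | triRoot-cantor a b = m+n∸n≡m a b

unpair₂ᴿ : ∀ {n a} → Recursive n a → Recursive n (λ xs → unpair₂ (a xs))
unpair₂ᴿ ra = app₂ ∸ᴿ ra (app₁ triᴿ (app₁ triRootᴿ ra))

unpair₁ᴿ : ∀ {n a} → Recursive n a → Recursive n (λ xs → unpair₁ (a xs))
unpair₁ᴿ ra = app₂ ∸ᴿ (app₁ triRootᴿ ra) (unpair₂ᴿ ra)

opaque
  hd : ℕ → ℕ
  hd c = unpair₁ (pred c)

  tl : ℕ → ℕ
  tl c = unpair₂ (pred c)

  hd-∷ : ∀ x l → hd (codeList (x ∷ l)) ≡ x
  hd-∷ x l = unpair₁-cantor x (codeList l)

  tl-∷ : ∀ x l → tl (codeList (x ∷ l)) ≡ codeList l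
  tl-∷ x l = unpair₂-cantor x (codeList l)

  tl-0 : tl 0 ≡ 0
  tl-0 = refl

  tlᴿ : Recursive 1 (unary tl)
  tlᴿ = Recursive-≗ (unpair₂ᴿ (app₁ predᴿ (var (# 0)))) λ { (_ ∷ []) → refl }

  hdᴿ : Recursive 1 (unary hd)
  hdᴿ = Recursive-≗ (unpair₁ᴿ (app₁ predᴿ (var (# 0)))) λ { (_ ∷ []) → refl }

iterate-fixed : ∀ (f : ℕ → ℕ) {x} → f x ≡ x → ∀ j → iterate f x j ≡ x
iterate-fixed f fx≡x zero    = refl
iterate-fixed f fx≡x (suc j) rewrite fx≡x = iterate-fixed f fx≡x j

iterate-tl : ∀ l j → iterate tl (codeList l) j ≡ codeList (drop j l)
iterate-tl l       zero    = refl
iterate-tl []      (suc j) rewrite tl-0 = iterate-fixed tl tl-0 j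
iterate-tl (x ∷ l) (suc j) rewrite tl-∷ x l = iterate-tl l j

length≤codeList : ∀ l → length l ≤ codeList l
length≤codeList []      = z≤n
length≤codeList (x ∷ l) = s≤s (≤-trans (length≤codeList l) (m≤n+m (codeList l) (tri (x + codeList l))))

drop-applyUpTo : ∀ (q : ℕ → ℕ) j t → drop j (applyUpTo q t) ≡ applyUpTo (λ y → q (j + y)) (t ∸ j)
drop-applyUpTo q zero    t       = refl
drop-applyUpTo q (suc j) zero    = refl
drop-applyUpTo q (suc j) (suc t) = drop-applyUpTo (q ∘ suc) j t

iterate-tl-≡0 : ∀ q {j t} → t ≤ j → iterate tl (codeList (applyUpTo q t)) j ≡ 0
iterate-tl-≡0 q {j} {t} t≤j
  rewrite iterate-tl (applyUpTo q t) j | drop-applyUpTo q j t | m≤n⇒m∸n≡0 t≤j = refl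

iterate-tl-≢0 : ∀ q {j t} → j < t → iterate tl (codeList (applyUpTo q t)) j ≢ 0
iterate-tl-≢0 q {j} {t} j<t rewrite iterate-tl (applyUpTo q t) j | drop-applyUpTo q j t
  with t ∸ j | m>n⇒m∸n≢0 j<t
... | zero  | t∸j≢0 = λ _ → t∸j≢0 refl
... | suc _ | _     = λ ()

hd-iterate-tl : ∀ q {j t} → j < t → hd (iterate tl (codeList (applyUpTo q t)) j) ≡ q j
hd-iterate-tl q {j} {t} j<t rewrite iterate-tl (applyUpTo q t) j | drop-applyUpTo q j t
  with t ∸ j | m>n⇒m∸n≢0 j<t
... | zero  | t∸j≢0 = contradiction refl t∸j≢0
... | suc _ | _     = trans (hd-∷ _ _) (cong q (+-identityʳ j))

dropBlock : ℕ → ℕ → ℕ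
dropBlock d L = ifz (iterate tl L d) L (iterate tl L d)

-- L iterations suffice because a list is no longer than its code.
lastBlock : ℕ → ℕ → ℕ
lastBlock d L = hd (iterate (dropBlock d) L L)

dropBlock-short : ∀ d l → length l ≤ d → dropBlock d (codeList l) ≡ codeList l
dropBlock-short d l l≤d rewrite iterate-tl l d | drop-all d l l≤d = refl

dropBlock-long : ∀ d l → d < length l → dropBlock d (codeList l) ≡ codeList (drop d l)
dropBlock-long d l d<l rewrite iterate-tl l d with drop d l in eq
... | []    = contradiction (trans (sym (length-drop d l)) (cong length eq)) (m>n⇒m∸n≢0 d<l)
... | _ ∷ _ = refl

iterate-dropBlock : ∀ d {s} → s < d → ∀ u l → length l ≡ u * d + suc s → ∀ j → u ≤ j →
                    iterate (dropBlock d) (codeList l) j ≡ codeList (drop (u * d) l)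
iterate-dropBlock d s<d zero l len j _ =
  iterate-fixed (dropBlock d) (dropBlock-short d l (subst (_≤ d) (sym len) s<d)) j
iterate-dropBlock d {s} s<d (suc u) l len (suc j) (s≤s u≤j) = begin
  iterate (dropBlock d) (dropBlock d (codeList l)) j
    ≡⟨ cong (λ L → iterate (dropBlock d) L j) (dropBlock-long d l d<len) ⟩
  iterate (dropBlock d) (codeList (drop d l)) j
    ≡⟨ iterate-dropBlock d s<d u (drop d l) len′ j u≤j ⟩
  codeList (drop (u * d) (drop d l))
    ≡⟨ cong codeList (drop-drop d (u * d) l) ⟩
  codeList (drop (suc u * d) l)
    ∎
  where
  open ≡-Reasoning
  len≡ : length l ≡ d + (u * d + suc s)
  len≡ = trans len (+-assoc d (u * d) (suc s))
  len′ : length (drop d l) ≡ u * d + suc s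
  len′ = trans (length-drop d l) (trans (cong (_∸ d) len≡) (m+n∸m≡n d _))
  d<len : d < length l
  d<len = subst (d <_) (sym len≡) (m<m+n d (≤-trans (s≤s z≤n) (m≤n+m (suc s) (u * d))))

lastBlock-applyUpTo : ∀ (q : ℕ → ℕ) {d s} → s < d → ∀ u →
                      lastBlock d (codeList (applyUpTo q (u * d + suc s))) ≡ q (u * d)
lastBlock-applyUpTo q {d} {s} s<d u = begin
  hd (iterate (dropBlock d) L L)
    ≡⟨ cong hd (iterate-dropBlock d s<d u l (length-applyUpTo q t) L u≤L) ⟩
  hd (codeList (drop (u * d) l))
    ≡⟨ cong (hd ∘ codeList) (drop-applyUpTo q (u * d) t) ⟩
  hd (codeList (applyUpTo (λ y → q (u * d + y)) (t ∸ u * d)))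
    ≡⟨ cong (λ r → hd (codeList (applyUpTo (λ y → q (u * d + y)) r))) (m+n∸m≡n (u * d) (suc s)) ⟩
  hd (codeList (applyUpTo (λ y → q (u * d + y)) (suc s)))
    ≡⟨ trans (hd-∷ _ _) (cong q (+-identityʳ (u * d))) ⟩
  q (u * d)
    ∎
  where
  open ≡-Reasoning
  t = u * d + suc s
  l = applyUpTo q t
  L = codeList l
  u≤t : u ≤ t
  u≤t = ≤-trans (m≤m*n u d {{>-nonZero (≤-trans (s≤s z≤n) s<d)}}) (m≤m+n (u * d) (suc s))
  u≤L : u ≤ L
  u≤L = ≤-trans u≤t (subst (_≤ L) (length-applyUpTo q t) (length≤codeList l))

last-applyUpTo : ∀ (q : ℕ → ℕ) u → lastBlock 1 (codeList (applyUpTo q (suc u))) ≡ q u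
last-applyUpTo q u = begin
  lastBlock 1 (codeList (applyUpTo q (suc u)))     ≡⟨ cong (lastBlock 1 ∘ codeList ∘ applyUpTo q) len ⟨
  lastBlock 1 (codeList (applyUpTo q (u * 1 + 1))) ≡⟨ lastBlock-applyUpTo q (s≤s z≤n) u ⟩
  q (u * 1)                                        ≡⟨ cong q (*-identityʳ u) ⟩
  q u                                              ∎
  where
  open ≡-Reasoning
  len : u * 1 + 1 ≡ suc u
  len = trans (cong (_+ 1) (*-identityʳ u)) (+-comm u 1)

dropBlockᴿ : ∀ d → Recursive 1 (unary (dropBlock d))
dropBlockᴿ d = Recursive-≗ (app₃ ifzᴿ rest (var (# 0)) rest) λ { (_ ∷ []) → refl }
  where
  rest : Recursive 1 (λ xs → iterate tl (lookup xs (# 0)) d)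
  rest = app₂ (iterateᴿ tlᴿ) (const d) (var (# 0))

lastBlockᴿ : ∀ d → Recursive 1 (unary (lastBlock d))
lastBlockᴿ d = Recursive-≗ (app₁ hdᴿ (app₂ (iterateᴿ (dropBlockᴿ d)) (var (# 0)) (var (# 0))))
  λ { (_ ∷ []) → refl }

-- OutAt α p x is FirstNonzeroIs (λ t → α (x ∷ prefix p t)) by definition.
FirstNonzeroIs : (ℕ → ℕ) → ℕ → Set
FirstNonzeroIs h y = Σ ℕ λ t → h t ≡ suc y × (∀ t′ → t′ < t → h t′ ≡ 0)

firstNonzero : ∀ (h : ℕ → ℕ) t → h t ≢ 0 → Σ ℕ (FirstNonzeroIs h)
firstNonzero h t ht≢0 with searchBelow (suc t)
  where
  searchBelow : ∀ b → (∀ t′ → t′ < b → h t′ ≡ 0) ⊎ Σ ℕ (FirstNonzeroIs h)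
  searchBelow zero = inj₁ λ _ ()
  searchBelow (suc b) with searchBelow b
  ... | inj₂ found = inj₂ found
  ... | inj₁ zeros with h b in hb
  ...   | suc y = inj₂ (y , b , hb , zeros)
  ...   | zero  = inj₁ λ t′ t′<1+b → [ zeros t′ , (λ { refl → hb }) ]′ (m≤n⇒m<n∨m≡n (≤-pred t′<1+b))
... | inj₁ zeros = contradiction (zeros t ≤-refl) ht≢0
... | inj₂ found = found

firstNonzero-local : ∀ {h h′ y y′} ((t , _) : FirstNonzeroIs h y) → FirstNonzeroIs h′ y′ →
                     (∀ t′ → t′ ≤ t → h t′ ≡ h′ t′) → y ≡ y′
firstNonzero-local (t , ht , zeros) (t′ , h′t′ , zeros′) agree with <-cmp t t′
... | tri< t<t′ _ _ = contradiction (trans (sym ht) (trans (agree t ≤-refl) (zeros′ t t<t′))) λ ()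
... | tri≈ _ refl _ = suc-injective (trans (sym ht) (trans (agree t ≤-refl) h′t′))
... | tri> _ _ t′<t = contradiction (trans (sym h′t′) (trans (sym (agree t′ (<⇒≤ t′<t))) (zeros t′ t′<t))) λ ()

prefix-cong : ∀ {P P′ : Baire} t → (∀ z → z < t → P z ≡ P′ z) → prefix P t ≡ prefix P′ t
prefix-cong t agree = map-cong-local (applyUpTo⁺₁ id t λ {z} → agree z)

outAt-local : ∀ {α P P′ x y y′} ((t , _) : OutAt α P x y) → OutAt α P′ x y′ →
              (∀ z → z < t → P z ≡ P′ z) → y ≡ y′
outAt-local {α} {x = x} o o′ agree = firstNonzero-local o o′ λ t′ t′≤t →
  cong (λ l → α (x ∷ l)) (prefix-cong t′ λ z z<t′ → agree z (<-≤-trans z<t′ t′≤t))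

outAt-functional : ∀ {α P x y y′} → OutAt α P x y → OutAt α P x y′ → y ≡ y′
outAt-functional {α} {P} {x} o o′ = outAt-local {α} {P} {P} {x} o o′ λ _ _ → refl

outputOf : ∀ α p → (∀ x → Σ ℕ λ t → α (x ∷ prefix p t) ≢ 0) → Σ Baire (α ⊢ p ↦_)
outputOf α p halts = (λ x → proj₁ (search x)) , (λ x → proj₂ (search x))
  where
  search : ∀ x → Σ ℕ (OutAt α p x)
  search x = firstNonzero (λ t → α (x ∷ prefix p t)) (proj₁ (halts x)) (proj₂ (halts x))

ConvTo-unique : ∀ {m q i v v′} → ConvTo m q i v → ConvTo m q i v′ → v ≡ v′
ConvTo-unique (s₀ , conv) (s₁ , conv′) =
  trans (sym (conv (s₀ ⊔ s₁) (m≤m⊔n s₀ s₁))) (conv′ (s₀ ⊔ s₁) (m≤n⊔m s₀ s₁))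

ConvTo-bounded : ∀ {m n q i v} → (∀ x → q x < n) → ConvTo m q i v → v < n
ConvTo-bounded q<n (s₀ , conv) = subst (_< _) (conv s₀ ≤-refl) (q<n _)

limit : ∀ {m n q} → Problem.Inst (PHP′ m n) q → Fin m → Fin n
limit (q<n , conv) i = Fin.fromℕ< (ConvTo-bounded q<n (proj₂ (conv (toℕ i) (toℕ<n i))))

limit-converges : ∀ {m n q} (I : Problem.Inst (PHP′ m n) q) i → ConvTo m q (toℕ i) (toℕ (limit I i))
limit-converges {m} {q = q} (q<n , conv) i =
  subst (ConvTo m q (toℕ i)) (sym (toℕ-fromℕ< _)) (proj₂ (conv (toℕ i) (toℕ<n i)))

limit-solution : ∀ {m n q} (I : Problem.Inst (PHP′ m n) q) {i j} → toℕ i < toℕ j →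
                 limit I i ≡ limit I j → Problem.Sol (PHP′ m n) q (pairCode (toℕ i) (toℕ j))
limit-solution {m} {q = q} I {i} {j} i<j same =
  toℕ i , toℕ j , i<j , toℕ<n j , (λ _ → refl) , toℕ (limit I i) , limit-converges I i ,
  subst (ConvTo m q (toℕ j)) (cong toℕ (sym same)) (limit-converges I j)

PHPSol? : ∀ {m n} (h : Fin m → Fin n) i j → Dec (PHPSol h i j)
PHPSol? h i j = ¬? (i Fin.≟ j) ×-dec (h i Fin.≟ h j)

PHPSol-sym : ∀ {m n} {h : Fin m → Fin n} {i j} → PHPSol h i j → PHPSol h j i
PHPSol-sym (i≢j , hi≡hj) = i≢j ∘ sym , sym hi≡hj

ACC-appears-unique : ∀ {k p a b} → Problem.Inst (ACC k) p →
                     a < k → Appears a p → b < k → Appears b p → a ≡ b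
ACC-appears-unique (inj₁ (_ , _ , _ , unique)) a<k a∈p b<k b∈p =
  trans (unique _ a<k a∈p) (sym (unique _ b<k b∈p))
ACC-appears-unique (inj₂ p≡k) a<k (z , pz≡a) _ _ =
  contradiction (subst (_< _) (trans (sym pz≡a) (p≡k z)) a<k) (<-irrefl refl)

interleave-even : ∀ (p r : Baire) u → interleave p r (u * 2) ≡ p u
interleave-even p r zero    = refl
interleave-even p r (suc u) = interleave-even (p ∘ suc) (r ∘ suc) u

interleave-agree : ∀ {p p′ : Baire} r z → (∀ u → u ≤ z → p u ≡ p′ u) →
                   interleave p r z ≡ interleave p′ r z
interleave-agree r zero          agree = agree 0 z≤n
interleave-agree r (suc zero)    agree = refl
interleave-agree r (suc (suc z)) agree =
  interleave-agree (r ∘ suc) z λ u u≤z → agree (suc u) (m≤n⇒m≤1+n (s≤s u≤z))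

module InstanceMap {k m n : ℕ} (0<n : 0 < n) (g : Fin m → Fin n) (f : Fin k → Fin m → Fin n) where

  gColumn : ℕ → ℕ
  gColumn = select (toℕ ∘ g)

  fColumn : ℕ → ℕ → ℕ
  fColumn a i = select (λ ℓ → select (toℕ ∘ f ℓ) i) a

  -- Entry x of the image, after reading the values coded by L: f a at column x mod m if the
  -- last value a read is below k, and g at that column only once more than x values have been
  -- read, so that entry x never overlooks a value below k at a position y₀ ≤ x.
  φ-entry : ℕ → ℕ → ℕ
  φ-entry x L = ifz L 0 (ifLess (lastBlock 1 L) k (suc (fColumn (lastBlock 1 L) (modulo m x)))
                                (ifz (iterate tl L x) 0 (suc (gColumn (modulo m x)))))

  φ-entryᴿ : Recursive 1 (λ xs → φ-entry (hd (lookup xs (# 0))) (tl (lookup xs (# 0))))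
  φ-entryᴿ = app₃ ifzᴿ L (const 0) (ifLessᴿ last (const k) (app₁ sucᴿ fColᴿ)
                         (app₃ ifzᴿ (app₂ (iterateᴿ tlᴿ) x L) (const 0) (app₁ sucᴿ gColᴿ)))
    where
    x = app₁ hdᴿ (var (# 0))
    L = app₁ tlᴿ (var (# 0))
    last = app₁ (lastBlockᴿ 1) L
    column = app₁ (moduloᴿ m) x
    gColᴿ = selectᴿ (λ i → const (toℕ (g i))) column
    fColᴿ = selectᴿ (λ ℓ → selectᴿ (λ i → const (toℕ (f ℓ i))) column) last

  opaque
    αφ : Associate
    αφ l = φ-entry (hd (codeList l)) (tl (codeList l))

    αφ-computable : Computable αφ
    αφ-computable = proj₁ φ-entryᴿ , λ l → proj₂ φ-entryᴿ (codeList l ∷ [])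

    αφ-∷ : ∀ x l → αφ (x ∷ l) ≡ φ-entry x (codeList l)
    αφ-∷ x l = cong₂ φ-entry (hd-∷ x l) (tl-∷ x l)

  αφ-prefix : ∀ p x u → αφ (x ∷ prefix p (suc u)) ≡
    ifLess (p u) k (suc (fColumn (p u) (modulo m x)))
                   (ifz (iterate tl (codeList (applyUpTo p (suc u))) x) 0 (suc (gColumn (modulo m x))))
  αφ-prefix p x u = begin
    αφ (x ∷ prefix p (suc u))                  ≡⟨ αφ-∷ x (prefix p (suc u)) ⟩
    φ-entry x (codeList (prefix p (suc u)))    ≡⟨ cong (φ-entry x ∘ codeList) (map-upTo p (suc u)) ⟩
    φ-entry x (codeList (applyUpTo p (suc u)))
      ≡⟨ cong (λ a → ifLess a k (suc (fColumn a (modulo m x))) g-entry) (last-applyUpTo p u) ⟩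
    _                                          ∎
    where
    open ≡-Reasoning
    g-entry = ifz (iterate tl (codeList (applyUpTo p (suc u))) x) 0 (suc (gColumn (modulo m x)))

  αφ-read-f : ∀ {p} x {u} → p u < k → αφ (x ∷ prefix p (suc u)) ≡ suc (fColumn (p u) (modulo m x))
  αφ-read-f {p} x {u} pu<k = trans (αφ-prefix p x u) (ifLess-< _ _ pu<k)

  αφ-read-g : ∀ {p x u} → k ≤ p u → x ≤ u → αφ (x ∷ prefix p (suc u)) ≡ suc (gColumn (modulo m x))
  αφ-read-g {p} {x} {u} k≤pu x≤u rewrite αφ-prefix p x u | m≤n⇒m∸n≡0 k≤pu
    with iterate tl (codeList (applyUpTo p (suc u))) x | iterate-tl-≢0 p (s≤s x≤u)
  ... | zero  | L≢0 = contradiction refl L≢0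
  ... | suc _ | _   = refl

  αφ-wait : ∀ {p x u} → k ≤ p u → u < x → αφ (x ∷ prefix p (suc u)) ≡ 0
  αφ-wait {p} {x} {u} k≤pu u<x rewrite αφ-prefix p x u | m≤n⇒m∸n≡0 k≤pu
                                     | iterate-tl-≡0 p u<x = refl

  data φ-Step (p : Baire) (x : ℕ) : ℕ → ℕ → Set where
    read-f : ∀ {u} → p u < k → φ-Step p x (suc u) (fColumn (p u) (modulo m x))
    read-g : ∀ {u} → k ≤ p u → x ≤ u → φ-Step p x (suc u) (gColumn (modulo m x))

  φ-step : ∀ {p x t y} → αφ (x ∷ prefix p t) ≡ suc y → φ-Step p x t y
  φ-step {p} {x} {zero} eq = contradiction (trans (sym eq) (αφ-∷ x [])) λ ()
  φ-step {p} {x} {suc u} eq with p u <? k | x ≤? u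
  ... | yes pu<k | _       =
    subst (φ-Step p x (suc u)) (suc-injective (trans (sym (αφ-read-f x pu<k)) eq)) (read-f pu<k)
  ... | no pu≮k  | yes x≤u =
    subst (φ-Step p x (suc u)) (suc-injective (trans (sym (αφ-read-g k≤pu x≤u)) eq)) (read-g k≤pu x≤u)
    where k≤pu = ≮⇒≥ pu≮k
  ... | no pu≮k  | no x≰u  = contradiction (trans (sym eq) (αφ-wait (≮⇒≥ pu≮k) (≰⇒> x≰u))) λ ()

  αφ-halts-at : ∀ {p x u} → p u < k → αφ (x ∷ prefix p (suc u)) ≢ 0
  αφ-halts-at {x = x} pu<k eq = contradiction (trans (sym (αφ-read-f x pu<k)) eq) λ ()

  αφ-halts : ∀ p x → αφ (x ∷ prefix p (suc x)) ≢ 0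
  αφ-halts p x with p x <? k
  ... | yes px<k = αφ-halts-at px<k
  ... | no px≮k  = λ eq → contradiction (trans (sym (αφ-read-g (≮⇒≥ px≮k) ≤-refl)) eq) λ ()

  φ-output : ∀ p → Σ Baire (αφ ⊢ p ↦_)
  φ-output p = outputOf αφ p λ x → suc x , αφ-halts p x

  φ-step-bounded : ∀ {p x t y} → φ-Step p x t y → y < n
  φ-step-bounded (read-f _)   = select-< _ 0<n (λ ℓ → select-< _ 0<n (λ i → toℕ<n (f ℓ i)) _) _
  φ-step-bounded (read-g _ _) = select-< _ 0<n (λ i → toℕ<n (g i)) _

  limitColumn : ∀ {p} → Problem.Inst (ACC k) p → ℕ → ℕ
  limitColumn (inj₁ (ℓ , _)) = fColumn ℓ
  limitColumn (inj₂ _)       = gColumn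

  φ-step-constant : ∀ {p x t y} → (∀ z → p z ≡ k) → φ-Step p x t y → y ≡ gColumn (modulo m x)
  φ-step-constant p≡k (read-f {u} pu<k) = contradiction (subst (_< k) (p≡k u) pu<k) (<-irrefl refl)
  φ-step-constant p≡k (read-g _ _)      = refl

  φ-step-late : ∀ {p x t y ℓ y₀} → (∀ ℓ′ → ℓ′ < k → Appears ℓ′ p → ℓ′ ≡ ℓ) →
                p y₀ < k → y₀ ≤ x → t ≤ suc y₀ → φ-Step p x t y → y ≡ fColumn ℓ (modulo m x)
  φ-step-late unique _ _ _ (read-f {u} pu<k) = cong (λ a → fColumn a _) (unique _ pu<k (u , refl))
  φ-step-late {p} {y₀ = y₀} _ py₀<k y₀≤x t≤1+y₀ (read-g {u} k≤pu x≤u) =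
    contradiction (subst (λ z → k ≤ p z) u≡y₀ k≤pu) (<⇒≱ py₀<k)
    where
    u≡y₀ : u ≡ y₀
    u≡y₀ = ≤-antisym (≤-pred t≤1+y₀) (≤-trans y₀≤x x≤u)

  module _ {p q} (φp↦q : αφ ⊢ p ↦ q) where

    φ-bounded : ∀ x → q x < n
    φ-bounded x = φ-step-bounded (φ-step (proj₁ (proj₂ (φp↦q x))))

    φ-converges : (I : Problem.Inst (ACC k) p) → ∀ {i} → i < m → ConvTo m q i (limitColumn I i)
    φ-converges (inj₂ p≡k) {i} i<m = 0 , λ s _ → begin
      q (s * m + i)                  ≡⟨ φ-step-constant p≡k (φ-step (proj₁ (proj₂ (φp↦q (s * m + i))))) ⟩
      gColumn (modulo m (s * m + i)) ≡⟨ cong gColumn (modulo-column s i<m) ⟩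
      gColumn i                      ∎
      where open ≡-Reasoning
    φ-converges (inj₁ (ℓ , ℓ<k , (y₀ , py₀≡ℓ) , unique)) {i} i<m = y₀ , λ s y₀≤s → begin
      q (s * m + i)                    ≡⟨ late s y₀≤s (φp↦q (s * m + i)) ⟩
      fColumn ℓ (modulo m (s * m + i)) ≡⟨ cong (fColumn ℓ) (modulo-column s i<m) ⟩
      fColumn ℓ i                      ∎
      where
      open ≡-Reasoning
      py₀<k : p y₀ < k
      py₀<k = subst (_< k) (sym py₀≡ℓ) ℓ<k
      late : ∀ s → y₀ ≤ s → ∀ {y} → OutAt αφ p (s * m + i) y → y ≡ fColumn ℓ (modulo m (s * m + i))
      late s y₀≤s (t , eq , zeros) = φ-step-late unique py₀<k y₀≤x t≤1+y₀ (φ-step eq)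
        where
        y₀≤x : y₀ ≤ s * m + i
        y₀≤x = ≤-trans y₀≤s (≤-trans (m≤m*n s m {{>-nonZero (≤-<-trans z≤n i<m)}}) (m≤m+n _ i))
        t≤1+y₀ : t ≤ suc y₀
        t≤1+y₀ = ≮⇒≥ λ 1+y₀<t → αφ-halts-at py₀<k (zeros (suc y₀) 1+y₀<t)

    φ-instance : Problem.Inst (ACC k) p → Problem.Inst (PHP′ m n) q
    φ-instance I = φ-bounded , λ i i<m → limitColumn I i , φ-converges I i<m

module SolutionMap {k m n : ℕ} (2≤k : 2 ≤ k) (0<n : 0 < n) (g : Fin m → Fin n) (f : Fin k → Fin m → Fin n)
                   (no-common : ∀ i j → ¬ (PHPSol g i j × (∀ t → PHPSol (f t) i j))) where
  open InstanceMap 0<n g f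

  separator : ∀ {i j} → PHPSol g i j → ∃ λ t → ¬ PHPSol (f t) i j
  separator {i} {j} gs = ¬∀⟶∃¬ k _ (λ t → PHPSol? (f t) i j) λ all → no-common i j (gs , all)

  separatorCode : Fin m → Fin m → ℕ
  separatorCode i j with PHPSol? g i j
  ... | yes gs = suc (toℕ (proj₁ (separator gs)))
  ... | no _   = 0

  separatorCode-suc : ∀ {i j y} → separatorCode i j ≡ suc y →
                      ∃ λ t → toℕ t ≡ y × ¬ PHPSol (f t) i j
  separatorCode-suc {i} {j} eq with PHPSol? g i j
  ... | yes gs = proj₁ (separator gs) , suc-injective eq , proj₂ (separator gs)

  separatorCode-zero : ∀ {i j} → separatorCode i j ≡ 0 → ¬ PHPSol g i j
  separatorCode-zero {i} {j} eq with PHPSol? g i j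
  ... | no ¬gs = ¬gs

  separatorTable : ℕ → ℕ → ℕ
  separatorTable a b = select (λ i → select (separatorCode i) b) a

  avoid : ℕ → ℕ
  avoid c = ifz c 1 0

  decide : ℕ → ℕ → ℕ → ℕ
  decide w a b = ifz w (ifLess a k (suc (avoid a)) (ifLess b k (suc (avoid b)) 0)) w

  element : ℕ → ℕ → ℕ
  element j L = hd (iterate tl L j)

  -- Reading ⟨p, r⟩ with r naming {i, j}, the list L holds p 0, i, p 1, j, p 2, … and
  -- lastBlock 2 L is its last entry from p.
  ψ-answer : ℕ → ℕ
  ψ-answer L = ifz (iterate tl L 3) 0
    (decide (separatorTable (element 1 L) (element 3 L)) (element 0 L) (lastBlock 2 L))

  ψ-entryᴿ : Recursive 1 (λ xs → ifz (hd (lookup xs (# 0))) (ψ-answer (tl (lookup xs (# 0)))) 1)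
  ψ-entryᴿ = app₃ ifzᴿ (app₁ hdᴿ (var (# 0)))
    (app₃ ifzᴿ (app₂ (iterateᴿ tlᴿ) (const 3) L) (const 0)
      (app₃ ifzᴿ w (ifLessᴿ a (const k) (app₁ sucᴿ (avoidᴿ a))
                             (ifLessᴿ b (const k) (app₁ sucᴿ (avoidᴿ b)) (const 0))) w))
    (const 1)
    where
    L = app₁ tlᴿ (var (# 0))
    elementᴿ : ∀ j → Recursive 1 (λ xs → element j (tl (lookup xs (# 0))))
    elementᴿ j = app₁ hdᴿ (app₂ (iterateᴿ tlᴿ) (const j) L)
    avoidᴿ : ∀ {c} → Recursive 1 c → Recursive 1 (λ xs → avoid (c xs))
    avoidᴿ rc = app₃ ifzᴿ rc (const 1) (const 0)
    w = selectᴿ (λ i → selectᴿ (λ j → const (separatorCode i j)) (elementᴿ 3)) (elementᴿ 1)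
    a = elementᴿ 0
    b = app₁ (lastBlockᴿ 2) L

  opaque
    αψ : Associate
    αψ l = ifz (hd (codeList l)) (ψ-answer (tl (codeList l))) 1

    αψ-computable : Computable αψ
    αψ-computable = proj₁ ψ-entryᴿ , λ l → proj₂ ψ-entryᴿ (codeList l ∷ [])

    αψ-∷ : ∀ x l → αψ (x ∷ l) ≡ ifz x (ψ-answer (codeList l)) 1
    αψ-∷ x l = cong₂ (λ x L → ifz x (ψ-answer L) 1) (hd-∷ x l) (tl-∷ x l)

  Valid : Baire → ℕ → Set
  Valid p y = y < k × (∀ ℓ → ℓ < k → Appears ℓ p → y ≢ ℓ)

  avoid-valid : ∀ {p c} → Problem.Inst (ACC k) p → c < k → Appears c p → Valid p (avoid c)
  avoid-valid {c = c} I c<k c∈p =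
    avoid<k c , λ ℓ ℓ<k ℓ∈p eq → avoid≢ c (trans eq (ACC-appears-unique I ℓ<k ℓ∈p c<k c∈p))
    where
    avoid<k : ∀ c → avoid c < k
    avoid<k zero    = 2≤k
    avoid<k (suc _) = ≤-trans (s≤s z≤n) 2≤k
    avoid≢ : ∀ c → avoid c ≢ c
    avoid≢ zero    ()
    avoid≢ (suc _) ()

  data Decision (w a b : ℕ) : ℕ → Set where
    by-separator : ∀ {y} → w ≡ suc y → Decision w a b y
    by-avoiding  : ∀ {c} → c ≡ a ⊎ c ≡ b → c < k → Decision w a b (avoid c)

  decision : ∀ {w a b y} → decide w a b ≡ suc y → Decision w a b y
  decision {suc w} eq = by-separator eq
  decision {zero} {a} {b} {y} eq with a <? k | b <? k
  ... | yes a<k | _       =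
    subst (Decision 0 a b) (suc-injective (trans (sym (ifLess-< _ _ a<k)) eq)) (by-avoiding (inj₁ refl) a<k)
  ... | no a≮k  | yes b<k =
    subst (Decision 0 a b) (suc-injective (trans (sym (ifLess-< _ _ b<k)) decide≡)) (by-avoiding (inj₂ refl) b<k)
    where
    decide≡ : ifLess b k (suc (avoid b)) 0 ≡ suc y
    decide≡ = trans (sym (ifLess-≥ _ _ (≮⇒≥ a≮k))) eq
  ... | no a≮k  | no b≮k  =
    contradiction (trans (sym eq) (trans (ifLess-≥ _ _ (≮⇒≥ a≮k)) (ifLess-≥ _ _ (≮⇒≥ b≮k)))) λ ()

  decide-separator : ∀ w a b → w ≢ 0 → decide w a b ≢ 0
  decide-separator zero    a b w≢0 = contradiction refl w≢0
  decide-separator (suc w) a b _   = λ ()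

  decide-first : ∀ w a b → a < k → decide w a b ≢ 0
  decide-first zero    a b a<k eq = contradiction (trans (sym (ifLess-< _ _ a<k)) eq) λ ()
  decide-first (suc w) a b _      = λ ()

  decide-second : ∀ w a b → b < k → decide w a b ≢ 0
  decide-second (suc w) a b _ = λ ()
  decide-second zero a b b<k eq with a <? k
  ... | yes a<k = decide-first zero a b a<k eq
  ... | no a≮k  =
    contradiction (trans (sym (ifLess-< _ _ b<k)) (trans (sym (ifLess-≥ _ _ (≮⇒≥ a≮k))) eq)) λ ()

  module OnSolution {p q : Baire} (φp↦q : αφ ⊢ p ↦ q) {i j : ℕ} (i<j : i < j) (j<m : j < m)
                    {r : Baire} (r≡pair : ∀ x → r x ≡ pairCode i j x)
                    {v : ℕ} (i→v : ConvTo m q i v) (j→v : ConvTo m q j v) where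

    i′ j′ : Fin m
    i′ = Fin.fromℕ< (<-trans i<j j<m)
    j′ = Fin.fromℕ< j<m

    i′≢j′ : i′ ≢ j′
    i′≢j′ eq = <-irrefl (trans (sym (toℕ-fromℕ< _)) (trans (cong toℕ eq) (toℕ-fromℕ< j<m))) i<j

    column-solution : ∀ (h : Fin m → Fin n) → select (toℕ ∘ h) i ≡ select (toℕ ∘ h) j → PHPSol h i′ j′
    column-solution h eq = i′≢j′ , toℕ-injective (begin
      toℕ (h i′)                ≡⟨ select-toℕ (toℕ ∘ h) i′ ⟨
      select (toℕ ∘ h) (toℕ i′) ≡⟨ cong (select (toℕ ∘ h)) (toℕ-fromℕ< _) ⟩
      select (toℕ ∘ h) i        ≡⟨ eq ⟩
      select (toℕ ∘ h) j        ≡⟨ cong (select (toℕ ∘ h)) (toℕ-fromℕ< j<m) ⟨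
      select (toℕ ∘ h) (toℕ j′) ≡⟨ select-toℕ (toℕ ∘ h) j′ ⟩
      toℕ (h j′)                ∎)
      where open ≡-Reasoning

    same-limit : (I′ : Problem.Inst (ACC k) p) → limitColumn I′ i ≡ limitColumn I′ j
    same-limit I′ = trans (ConvTo-unique {m} {q} {i} (φ-converges φp↦q I′ (<-trans i<j j<m)) i→v)
                          (ConvTo-unique {m} {q} {j} j→v (φ-converges φp↦q I′ j<m))

    constant⇒g-solution : (∀ z → p z ≡ k) → PHPSol g i′ j′
    constant⇒g-solution p≡k = column-solution g (same-limit (inj₂ p≡k))

    appears⇒f-solution : Problem.Inst (ACC k) p → (ℓ : Fin k) → Appears (toℕ ℓ) p → PHPSol (f ℓ) i′ j′
    appears⇒f-solution (inj₂ p≡k) ℓ (z , pz≡ℓ) =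
      contradiction (subst (_< k) (trans (sym pz≡ℓ) (p≡k z)) (toℕ<n ℓ)) (<-irrefl refl)
    appears⇒f-solution I@(inj₁ (_ , _ , _ , unique)) ℓ ℓ∈p with unique (toℕ ℓ) (toℕ<n ℓ) ℓ∈p
    ... | refl = column-solution (f ℓ) (trans (sym (select-toℕ _ ℓ)) (trans (same-limit I) (select-toℕ _ ℓ)))

    W : ℕ
    W = separatorTable i j

    W≡separatorCode : W ≡ separatorCode i′ j′
    W≡separatorCode = begin
      row i                      ≡⟨ cong row (toℕ-fromℕ< (<-trans i<j j<m)) ⟨
      row (toℕ i′)               ≡⟨ select-toℕ _ i′ ⟩
      select (separatorCode i′) j ≡⟨ cong (select (separatorCode i′)) (toℕ-fromℕ< j<m) ⟨
      select (separatorCode i′) (toℕ j′) ≡⟨ select-toℕ _ j′ ⟩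
      separatorCode i′ j′        ∎
      where
      open ≡-Reasoning
      row = select (λ a → select (separatorCode a) j)

    separator-valid : Problem.Inst (ACC k) p → ∀ {y} → W ≡ suc y → Valid p y
    separator-valid I W≡1+y with separatorCode-suc (trans (sym W≡separatorCode) W≡1+y)
    ... | t , t≡y , ¬ft = subst (_< k) t≡y (toℕ<n t) , λ ℓ _ ℓ∈p y≡ℓ →
      ¬ft (appears⇒f-solution I t (subst (λ a → Appears a p) (sym (trans t≡y y≡ℓ)) ℓ∈p))

    P : Baire
    P = interleave p r

    ψ-prefix-short : ∀ {t} → t ≤ 3 → αψ (0 ∷ prefix P t) ≡ 0
    ψ-prefix-short {t} t≤3 rewrite αψ-∷ 0 (prefix P t) | map-upTo P t | iterate-tl-≡0 P t≤3 = refl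

    ψ-prefix : ∀ u {s} → s < 2 → 3 < u * 2 + suc s →
               αψ (0 ∷ prefix P (u * 2 + suc s)) ≡ decide W (p 0) (p u)
    ψ-prefix u {s} s<2 3<t = begin
      αψ (0 ∷ prefix P t)                ≡⟨ αψ-∷ 0 (prefix P t) ⟩
      ψ-answer (codeList (prefix P t))    ≡⟨ cong (ψ-answer ∘ codeList) (map-upTo P t) ⟩
      ψ-answer L                         ≡⟨ ifz-≢0 0 _ (iterate-tl-≢0 P 3<t) ⟩
      decide (separatorTable (element 1 L) (element 3 L)) (element 0 L) (lastBlock 2 L)
        ≡⟨ cong₂ (λ w b → decide w (element 0 L) b) (cong₂ separatorTable element-1 element-3)
                 (lastBlock-applyUpTo P s<2 u) ⟩
      decide W (element 0 L) (P (u * 2))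
        ≡⟨ cong₂ (decide W) (hd-iterate-tl P (≤-trans (s≤s z≤n) 3<t)) (interleave-even p r u) ⟩
      decide W (p 0) (p u)
        ∎
      where
      open ≡-Reasoning
      t = u * 2 + suc s
      L = codeList (applyUpTo P t)
      element-1 : element 1 L ≡ i
      element-1 = trans (hd-iterate-tl P (≤-trans (s≤s (s≤s z≤n)) 3<t)) (r≡pair 0)
      element-3 : element 3 L ≡ j
      element-3 = trans (hd-iterate-tl P 3<t) (r≡pair 1)

    ψ-valid : Problem.Inst (ACC k) p → ∀ {t y} → αψ (0 ∷ prefix P t) ≡ suc y → Valid p y
    ψ-valid I {t} eq with t ≤? 3
    ... | yes t≤3 = contradiction (trans (sym eq) (ψ-prefix-short t≤3)) λ ()
    ψ-valid I {zero} eq | no t≰3 = contradiction z≤n t≰3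
    ψ-valid I {suc t′} {y} eq | no t≰3 with decision {W} {p 0} {p (t′ / 2)} decide≡
      where
      t≡ : suc t′ ≡ (t′ / 2) * 2 + suc (t′ % 2)
      t≡ = trans (cong suc (trans (m≡m%n+[m/n]*n t′ 2) (+-comm (t′ % 2) _))) (sym (+-suc _ (t′ % 2)))
      decide≡ : decide W (p 0) (p (t′ / 2)) ≡ suc y
      decide≡ = trans (sym (ψ-prefix (t′ / 2) (m%n<n t′ 2) (subst (3 <_) t≡ (≰⇒> t≰3))))
                      (trans (cong (λ t → αψ (0 ∷ prefix P t)) (sym t≡)) eq)
    ... | by-separator W≡1+y          = separator-valid I W≡1+y
    ... | by-avoiding (inj₁ refl) c<k = avoid-valid I c<k (0 , refl)
    ... | by-avoiding (inj₂ refl) c<k = avoid-valid I c<k (t′ / 2 , refl)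

    ψ-prefix-4 : αψ (0 ∷ prefix P 4) ≡ decide W (p 0) (p 1)
    ψ-prefix-4 = ψ-prefix 1 (s≤s (s≤s z≤n)) ≤-refl

    ψ-halts : Problem.Inst (ACC k) p → Σ ℕ λ t → αψ (0 ∷ prefix P t) ≢ 0
    ψ-halts I with W ≟ 0
    ... | no W≢0 = 4 , λ eq → decide-separator W (p 0) (p 1) W≢0 (trans (sym ψ-prefix-4) eq)
    ψ-halts (inj₂ p≡k) | yes W≡0 =
      contradiction (constant⇒g-solution p≡k) (separatorCode-zero (trans (sym W≡separatorCode) W≡0))
    ψ-halts (inj₁ (ℓ , ℓ<k , (zero , p0≡ℓ) , _)) | yes _ =
      4 , λ eq → decide-first W (p 0) (p 1) (subst (_< k) (sym p0≡ℓ) ℓ<k) (trans (sym ψ-prefix-4) eq)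
    ψ-halts (inj₁ (ℓ , ℓ<k , (suc u , pu≡ℓ) , _)) | yes _ =
      suc u * 2 + 2 , λ eq → decide-second W (p 0) (p (suc u)) (subst (_< k) (sym pu≡ℓ) ℓ<k)
        (trans (sym (ψ-prefix (suc u) (s≤s (s≤s z≤n)) (s≤s (s≤s (m≤n+m 2 (u * 2)))))) eq)

    ψ-solution : Problem.Inst (ACC k) p → Σ Baire λ s → (αψ ⊢ P ↦ s) × Problem.Sol (ACC k) p s
    ψ-solution I = s , ψP↦s , s 0 , proj₁ valid , entries , proj₂ valid
      where
      halts : ∀ x → Σ ℕ λ t → αψ (x ∷ prefix P t) ≢ 0
      halts zero    = ψ-halts I
      halts (suc x) = 0 , λ eq → contradiction (trans (sym eq) (αψ-∷ (suc x) [])) λ ()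
      s = proj₁ (outputOf αψ P halts)
      ψP↦s = proj₂ (outputOf αψ P halts)
      valid : Valid p (s 0)
      valid = ψ-valid I (proj₁ (proj₂ (ψP↦s 0)))
      entries : ∀ x → s x ≡ natCode (s 0) x
      entries zero    = refl
      entries (suc x) = outAt-functional {αψ} {P} (ψP↦s (suc x)) (0 , αψ-∷ (suc x) [] , λ _ ())

  reduction : ACC k ≤W PHP′ m n
  reduction = αφ , αψ , αφ-computable , αψ-computable , λ p I →
    let (q , φp↦q) = φ-output p in
    q , φp↦q , φ-instance φp↦q I ,
    λ { r (i , j , i<j , j<m , r≡pair , v , i→v , j→v) →
          OnSolution.ψ-solution φp↦q i<j j<m r≡pair i→v j→v I }

maxOver : ∀ {N} → (Fin N → ℕ) → ℕ
maxOver {zero}  h = 0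
maxOver {suc N} h = h Fin.zero ⊔ maxOver (h ∘ Fin.suc)

≤-maxOver : ∀ {N} (h : Fin N → ℕ) i → h i ≤ maxOver h
≤-maxOver h Fin.zero    = m≤m⊔n _ _
≤-maxOver h (Fin.suc i) = m≤n⇒m≤o⊔n (h Fin.zero) (≤-maxOver (h ∘ Fin.suc) i)

module FromReduction {k m n : ℕ} {Adm : Associate → Set} (red : RedWith Adm (ACC k) (PHP′ m n)) where

  ψ : Associate
  ψ = proj₁ (proj₂ red)

  reduce : ∀ p → Problem.Inst (ACC k) p → Σ Baire λ q → (proj₁ red ⊢ p ↦ q) × Problem.Inst (PHP′ m n) q ×
             (∀ r → Problem.Sol (PHP′ m n) q r →
                Σ Baire λ s → (ψ ⊢ interleave p r ↦ s) × Problem.Sol (ACC k) p s)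
  reduce = proj₂ (proj₂ (proj₂ (proj₂ red)))

  image-instance : ∀ {p} (I : Problem.Inst (ACC k) p) → Problem.Inst (PHP′ m n) (proj₁ (reduce p I))
  image-instance {p} I = proj₁ (proj₂ (proj₂ (reduce p I)))

  solve : ∀ {p} (I : Problem.Inst (ACC k) p) (i j : Fin m) → toℕ i < toℕ j →
          limit (image-instance I) i ≡ limit (image-instance I) j →
          Σ Baire λ s → (ψ ⊢ interleave p (pairCode (toℕ i) (toℕ j)) ↦ s) × Problem.Sol (ACC k) p s
  solve {p} I i j i<j same = proj₂ (proj₂ (proj₂ (reduce p I))) _ (limit-solution (image-instance I) i<j same)

  constant-k : Baire
  constant-k _ = k

  constant-k-instance : Problem.Inst (ACC k) constant-k
  constant-k-instance = inj₂ λ _ → refl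

  g : Fin m → Fin n
  g = limit (image-instance constant-k-instance)

  -- how much of ⟨kᵚ, {i, j}⟩ the solution map reads before answering
  modulus : Fin m → Fin m → ℕ
  modulus i j with toℕ i <? toℕ j | g i Fin.≟ g j
  ... | yes i<j | yes gi≡gj = proj₁ (proj₁ (proj₂ (solve constant-k-instance i j i<j gi≡gj)) 0)
  ... | _       | _         = 0

  T : ℕ
  T = maxOver λ i → maxOver (modulus i)

  modulus≤T : ∀ i j → modulus i j ≤ T
  modulus≤T i j = ≤-trans (≤-maxOver (modulus i) j) (≤-maxOver (λ i → maxOver (modulus i)) i)

  switch : ℕ → Baire
  switch ℓ x = ifLess x T k ℓ

  switch-appears : ∀ ℓ → Appears ℓ (switch ℓ)
  switch-appears ℓ = T , ifLess-≥ {T} k ℓ ≤-refl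

  switch-instance : (ℓ : Fin k) → Problem.Inst (ACC k) (switch (toℕ ℓ))
  switch-instance ℓ = inj₁ (toℕ ℓ , toℕ<n ℓ , switch-appears (toℕ ℓ) , unique)
    where
    unique : ∀ ℓ′ → ℓ′ < k → Appears ℓ′ (switch (toℕ ℓ)) → ℓ′ ≡ toℕ ℓ
    unique ℓ′ ℓ′<k (z , eq) with z <? T
    ... | yes z<T = contradiction (subst (_< k) (trans (sym eq) (ifLess-< k (toℕ ℓ) z<T)) ℓ′<k) (<-irrefl refl)
    ... | no z≮T  = trans (sym eq) (ifLess-≥ k (toℕ ℓ) (≮⇒≥ z≮T))

  f : Fin k → Fin m → Fin n
  f ℓ = limit (image-instance (switch-instance ℓ))

  -- go repeats the case split defining modulus i j, so that its bound speaks about this run.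
  bounded-run : ∀ i j → toℕ i < toℕ j → g i ≡ g j →
                Σ Baire λ s → Σ (ψ ⊢ interleave constant-k (pairCode (toℕ i) (toℕ j)) ↦ s)
                                (λ out → proj₁ (out 0) ≤ T) × Problem.Sol (ACC k) constant-k s
  bounded-run i j i<j gi≡gj = go (modulus≤T i j)
    where
    go : modulus i j ≤ T → _
    go mod≤T with toℕ i <? toℕ j | g i Fin.≟ g j
    ... | yes i<j′ | yes gi≡gj′ =
      let (s , out , sol) = solve constant-k-instance i j i<j′ gi≡gj′ in s , (out , mod≤T) , sol
    ... | no i≮j   | _          = contradiction i<j i≮j
    ... | yes _    | no gi≢gj   = contradiction gi≡gj gi≢gj

  same-answer : ∀ {ℓ r s s′} (out : ψ ⊢ interleave constant-k r ↦ s) → proj₁ (out 0) ≤ T →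
                ψ ⊢ interleave (switch ℓ) r ↦ s′ → s 0 ≡ s′ 0
  same-answer {ℓ} {r} out t≤T out′ =
    outAt-local {ψ} {interleave constant-k r} {interleave (switch ℓ) r} (out 0) (out′ 0) λ z z<t →
      interleave-agree r z λ u u≤z → sym (ifLess-< k ℓ (≤-<-trans u≤z (<-≤-trans z<t t≤T)))

  no-common-ordered : ∀ i j → toℕ i < toℕ j → PHPSol g i j → ¬ (∀ t → PHPSol (f t) i j)
  no-common-ordered i j i<j (_ , gi≡gj) all-f with bounded-run i j i<j gi≡gj
  ... | s , (out , t≤T) , (ℓ₀ , ℓ₀<k , s≡ℓ₀ , _)
    with solve (switch-instance (Fin.fromℕ< ℓ₀<k)) i j i<j (proj₂ (all-f (Fin.fromℕ< ℓ₀<k)))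
  ... | s′ , out′ , (ℓ₁ , _ , s′≡ℓ₁ , avoids) = avoids _ (toℕ<n ℓ) (switch-appears (toℕ ℓ)) (begin
    ℓ₁     ≡⟨ s′≡ℓ₁ 0 ⟨
    s′ 0   ≡⟨ same-answer out t≤T out′ ⟨
    s 0    ≡⟨ s≡ℓ₀ 0 ⟩
    ℓ₀     ≡⟨ toℕ-fromℕ< ℓ₀<k ⟨
    toℕ ℓ  ∎)
    where
    open ≡-Reasoning
    ℓ = Fin.fromℕ< ℓ₀<k

  no-common : ∀ i j → ¬ (PHPSol g i j × (∀ t → PHPSol (f t) i j))
  no-common i j (gs , all-f) with <-cmp (toℕ i) (toℕ j)
  ... | tri< i<j _ _ = no-common-ordered i j i<j gs all-f
  ... | tri≈ _ i≡j _ = proj₁ gs (toℕ-injective i≡j)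
  ... | tri> _ _ j<i = no-common-ordered j i j<i (PHPSol-sym gs) (PHPSol-sym ∘ all-f)

≤W⇒≤W* : ∀ {P Q} → P ≤W Q → P ≤W* Q
≤W⇒≤W* (φ , ψ , _ , _ , reduce) = φ , ψ , tt , tt , reduce

theorem3p12 : (k m n : ℕ) → 2 ≤ k → 2 ≤ n → n < m →
    (NoCommonSolution m n k ⇔ (ACC k ≤W PHP′ m n)) ×
    (NoCommonSolution m n k ⇔ (ACC k ≤W* PHP′ m n))
theorem3p12 k m n 2≤k 2≤n _ = mk⇔ reduction (common ∘ ≤W⇒≤W*) , mk⇔ (≤W⇒≤W* ∘ reduction) common
  where
  reduction : NoCommonSolution m n k → ACC k ≤W PHP′ m n
  reduction (g , f , no-common) = SolutionMap.reduction 2≤k (≤-trans (s≤s z≤n) 2≤n) g f no-common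
  common : ACC k ≤W* PHP′ m n → NoCommonSolution m n k
  common red = FromReduction.g red , FromReduction.f red , FromReduction.no-common red
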